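{- Let $Q = Q_T$ be the quiver of a triangulation $T$ of a convex polygon, and suppose that $Q$ consists entirely of oriented 3-cycles, i.e. every vertex and every arrow of $Q$ lies in some oriented 3-cycle of $Q$. Let $G_Q$ be the graph whose vertices are the oriented 3-cycles $T_i$ of $Q$, with an edge between $i$ and $j$ ($i \neq j$) whenever $T_i$ and $T_j$ share a vertex. Then $G_Q$ is a tree.
   Context: For a convex polygon $S$ with $m$ vertices, an arc is a diagonal of $S$, and a triangulation $T$ is a maximal collection of arcs which pairwise do not intersect in the interior of $S$. The quiver $Q_T$ has one vertex for each arc of $T$, and for any two arcs $i, j$ that are sides of a common triangle $\Delta$ of $T$, an arrow $i \to j$ if $j$ follows $i$ in $\Delta$ with respect to the counterclockwise orientation of $S$. -}

module Defs where

open import Data.Nat using (ℕ; zero; suc; _+_; _<_; _≤_)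
open import Data.Product using (Σ; ∃; _×_; _,_)
open import Data.Sum using (_⊎_)
open import Data.Empty using (⊥)
open import Data.List using (List; []; _∷_; _++_; [_]; length)
open import Data.List.Relation.Unary.All using (All)
open import Data.List.Relation.Unary.Linked using (Linked)
open import Data.List.Relation.Unary.Unique.Propositional using (Unique)
open import Data.List.Membership.Propositional using (_∈_; _∉_)
open import Relation.Nullary using (¬_)
open import Relation.Binary.PropositionalEquality using (_≡_; _≢_)

-- Convex polygon S with m vertices, labelled 0,1,…,m-1 in
-- counterclockwise order.  A segment between two polygon vertices is
-- represented as a pair (a , b) of natural numbers with a < b < m.

Seg : Set
Seg = ℕ × ℕ

IsSide : ℕ → Seg → Set
IsSide m (a , b) = (a < b × b < m) × (b ≡ suc a ⊎ (a ≡ 0 × suc b ≡ m))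

IsArc : ℕ → Seg → Set
IsArc m (a , b) = (a < b × b < m) × (b ≢ suc a × (a ≡ 0 → suc b ≢ m))

Cross : Seg → Seg → Set
Cross (a , b) (c , d) = (a < c × c < b × b < d) ⊎ (c < a × a < d × d < b)

record IsTriangulation (m : ℕ) (T : List Seg) : Set where
  field
    arcs        : ∀ {x} → x ∈ T → IsArc m x
    noncrossing : ∀ {x y} → x ∈ T → y ∈ T → ¬ Cross x y
    maximal     : ∀ x → IsArc m x → x ∉ T → ∃ λ y → y ∈ T × Cross x y

EdgeOf : ℕ → List Seg → Seg → Set
EdgeOf m T x = IsSide m x ⊎ x ∈ T

IsTriangle : ℕ → List Seg → ℕ → ℕ → ℕ → Set
IsTriangle m T a b c =
  (a < b × b < c × c < m) ×
  (EdgeOf m T (a , b) × EdgeOf m T (b , c) × EdgeOf m T (a , c))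

-- In the triangle a < b < c (counterclockwise a, b, c), the sides in
-- counterclockwise order are (a,b), (b,c), (c,a).  "y follows x":
Follows : ℕ → ℕ → ℕ → Seg → Seg → Set
Follows a b c x y =
  (x ≡ (a , b) × y ≡ (b , c)) ⊎
  ((x ≡ (b , c) × y ≡ (a , c)) ⊎
   (x ≡ (a , c) × y ≡ (a , b)))

QVertex : List Seg → Seg → Set
QVertex T x = x ∈ T

Arrow : ℕ → List Seg → Seg → Seg → Set
Arrow m T x y =
  x ∈ T × y ∈ T ×
  ∃ λ a → ∃ λ b → ∃ λ c → IsTriangle m T a b c × Follows a b c x y

Cycle3 : ℕ → List Seg → Seg → Seg → Seg → Set
Cycle3 m T x y z = Arrow m T x y × Arrow m T y z × Arrow m T z x

AllIn3Cycles : ℕ → List Seg → Set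
AllIn3Cycles m T =
  (∀ x → QVertex T x → ∃ λ y → ∃ λ z → Cycle3 m T x y z) ×
  (∀ x y → Arrow m T x y → ∃ λ z → Cycle3 m T x y z)

-- The graph G_Q.  An oriented 3-cycle (as a subquiver, i.e. up to
-- rotation) is represented canonically by the rotation (x , y , z)
-- whose first arc x is lexicographically smallest.

_<ₛ_ : Seg → Seg → Set
(a , b) <ₛ (c , d) = a < c ⊎ (a ≡ c × b < d)

Cyc : Set
Cyc = Seg × Seg × Seg

GVertex : ℕ → List Seg → Cyc → Set
GVertex m T (x , y , z) = Cycle3 m T x y z × (x <ₛ y × x <ₛ z)

InCyc : Seg → Cyc → Set
InCyc v (x , y , z) = v ≡ x ⊎ (v ≡ y ⊎ v ≡ z)

GEdge : Cyc → Cyc → Set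
GEdge s t = s ≢ t × ∃ λ v → InCyc v s × InCyc v t

data Walk {A : Set} (V : A → Set) (E : A → A → Set) : A → A → Set where
  here  : ∀ {u} → Walk V E u u
  step  : ∀ {u w v} → E u w → V w → Walk V E w v → Walk V E u v

HasCycle : {A : Set} → (A → Set) → (A → A → Set) → Set
HasCycle {A} V E =
  Σ A λ u → Σ (List A) λ xs →
    2 ≤ length xs × All V (u ∷ xs) × Unique (u ∷ xs) ×
    Linked E (u ∷ xs ++ [ u ])

record IsTree {A : Set} (V : A → Set) (E : A → A → Set) : Set where
  field
    nonempty  : Σ A V
    connected : ∀ u v → V u → V v → Walk V E u v
    acyclic   : ¬ HasCycle V E

-- The 3-cycles of Q_T are exactly the internal triangles a < b < c of T, all
-- of whose sides are arcs; such a triangle lies below its outer side (a , c).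
-- Two internal triangles sharing an arc lie on opposite sides of it, so every
-- edge of G_Q joins a triangle to its parent, the internal triangle across its
-- outer side. Parents are unique and have larger span c - a, so G_Q is acyclic.
-- If an arc of T covers the outer side of an internal triangle, the triangle
-- below that arc has two sides in T; the arrow between them lies on a 3-cycle,
-- so that triangle is internal too. Descending through such triangles joins
-- every internal triangle to the one below a single top arc, an inner side of
-- the triangle of T on the polygon side (0 , m - 1).

module Submission where

open import Defs
open import Data.Nat using (ℕ; suc; _∸_; _<_; _≤_; z≤n; s≤s; z<s; _≟_; _<?_; >-nonZero)
open import Data.Nat.Properties
open import Data.Nat.Induction using (<-wellFounded)
open import Induction.WellFounded using (Acc; acc)
open import Data.Product using (Σ; ∃; ∃-syntax; _×_; _,_; proj₁; proj₂)
open import Data.Product.Properties using (≡-dec)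
open import Data.Sum using (_⊎_; inj₁; inj₂; [_,_]′; assocˡ)
open import Data.Empty using (⊥; ⊥-elim)
open import Data.Unit using (⊤; tt)
open import Function using (_∘_; flip)
open import Data.List using (List; []; _∷_; _++_; [_])
open import Data.List.Relation.Unary.All as All using (All; []; _∷_)
import Data.List.Relation.Unary.All.Properties as All
open import Data.List.Relation.Unary.AllPairs using ([]; _∷_)
open import Data.List.Relation.Unary.Any using (here; there)
open import Data.List.Relation.Unary.Linked as Linked using (Linked; []; [-]; _∷_)
open import Data.List.Relation.Unary.Linked.Properties using (Linked⇒All)
open import Data.List.Relation.Unary.Unique.Propositional using (Unique)
import Data.List.Relation.Unary.Unique.Propositional.Properties as Unique
open import Data.List.Membership.Propositional using (_∈_)
open import Data.List.Membership.DecPropositional (≡-dec _≟_ _≟_) using (_∈?_)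
open import Relation.Nullary using (¬_; Dec; yes; no)
open import Relation.Nullary.Decidable using (_×-dec_; _⊎-dec_)
open import Relation.Binary using (tri<; tri≈; tri>)
open import Relation.Binary.PropositionalEquality using (_≡_; _≢_; refl; sym; trans; cong; subst)

module _ {A : Set} {V : A → Set} {E : A → A → Set} where

  walk-++ : ∀ {u v w} → Walk V E u v → Walk V E v w → Walk V E u w
  walk-++ here q = q
  walk-++ (step e Vx p) q = step e Vx (walk-++ p q)

  walk-reverse : (∀ {x y} → E x y → E y x) → ∀ {u v} → V u → Walk V E u v → Walk V E v u
  walk-reverse E-sym Vu here = here
  walk-reverse E-sym Vu (step e Vw p) = walk-++ (walk-reverse E-sym Vw p) (step (E-sym e) Vu here)

-- A cycle is a closed non-backtracking walk; since a vertex has only one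
-- parent, such a walk that steps down to a child once keeps stepping down.
module Forest {A : Set} (V : A → Set) (E : A → A → Set)
  (_↑_ : A → A → Set) (rank : A → ℕ)
  (orient : ∀ {u v} → V u → V v → E u v → u ↑ v ⊎ v ↑ u)
  (↑-functional : ∀ {u v w} → u ↑ v → u ↑ w → v ≡ w)
  (↑-rank : ∀ {u v} → u ↑ v → rank u < rank v) where

  NonBacktracking : List A → Set
  NonBacktracking (x ∷ y ∷ z ∷ zs) = x ≢ z × NonBacktracking (y ∷ z ∷ zs)
  NonBacktracking _ = ⊤

  unique⇒nonBacktracking : ∀ {xs} → Unique xs → NonBacktracking xs
  unique⇒nonBacktracking {_ ∷ _ ∷ _ ∷ _} ((_ ∷ x≢z ∷ _) ∷ uniq) = x≢z , unique⇒nonBacktracking uniq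
  unique⇒nonBacktracking {[]} _ = tt
  unique⇒nonBacktracking {_ ∷ []} _ = tt
  unique⇒nonBacktracking {_ ∷ _ ∷ []} _ = tt

  NonBacktrackingWalk : List A → Set
  NonBacktrackingWalk xs = All V xs × Linked E xs × NonBacktracking xs

  descends : ∀ {v w} rest → NonBacktrackingWalk (v ∷ w ∷ rest) → w ↑ v →
             All (λ x → rank x < rank v) (w ∷ rest)
  descends [] _ w↑v = ↑-rank w↑v ∷ []
  descends (r ∷ rest) (_ ∷ Vs@(Vw ∷ Vr ∷ _) , _ ∷ es@(w~r ∷ _) , v≢r , nb) w↑v with orient Vw Vr w~r
  ... | inj₁ w↑r = ⊥-elim (v≢r (↑-functional w↑v w↑r))
  ... | inj₂ r↑w = ↑-rank w↑v ∷ All.map (λ x<w → <-trans x<w (↑-rank w↑v)) (descends rest (Vs , es , nb) r↑w)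

  rises-or-falls-into : ∀ {v w} ws {z} → NonBacktrackingWalk (v ∷ w ∷ ws ++ [ z ]) →
                        Linked _↑_ (v ∷ w ∷ ws ++ [ z ]) ⊎ ∃[ y ] y ∈ w ∷ ws × z ↑ y
  rises-or-falls-into [] (Vv ∷ Vw ∷ Vz ∷ [] , v~w ∷ w~z ∷ [-] , v≢z , _) with orient Vw Vz w~z | orient Vv Vw v~w
  ... | inj₂ z↑w | _        = inj₂ (_ , here refl , z↑w)
  ... | inj₁ w↑z | inj₁ v↑w = inj₁ (v↑w ∷ w↑z ∷ [-])
  ... | inj₁ w↑z | inj₂ w↑v = ⊥-elim (v≢z (↑-functional w↑v w↑z))
  rises-or-falls-into (r ∷ ws) (Vv ∷ Vs , v~w ∷ es , v≢r , nb) with rises-or-falls-into ws (Vs , es , nb)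
  ... | inj₂ (y , y∈ , z↑y) = inj₂ (y , there y∈ , z↑y)
  ... | inj₁ rising@(w↑r ∷ _) with orient Vv (All.head Vs) v~w
  ...   | inj₁ v↑w = inj₁ (v↑w ∷ rising)
  ...   | inj₂ w↑v = ⊥-elim (v≢r (↑-functional w↑v w↑r))

  closed-walk : ∀ {u x y} ys → All V (u ∷ x ∷ y ∷ ys) → Unique (u ∷ x ∷ y ∷ ys) →
                Linked E (u ∷ x ∷ y ∷ ys ++ [ u ]) → NonBacktrackingWalk (u ∷ x ∷ y ∷ ys ++ [ u ])
  closed-walk {u} {x} {y} ys Vs@(Vu ∷ _) uniq@((_ ∷ u≢y ∷ _) ∷ uniq′) es =
    All.++⁺ Vs (Vu ∷ []) , es , u≢y , unique⇒nonBacktracking (Unique.++⁺ uniq′ ([] ∷ []) disjoint)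
    where
    disjoint : ∀ {v} → ¬ (v ∈ x ∷ y ∷ ys × v ∈ [ u ])
    disjoint (v∈ , here refl) = Unique.Unique[x∷xs]⇒x∉xs uniq v∈

  All-last : ∀ {P : A → Set} xs {z} → All P (xs ++ [ z ]) → P z
  All-last xs = All.head ∘ All.++⁻ʳ xs

  acyclic : ¬ HasCycle V E
  acyclic (_ , [] , () , _)
  acyclic (_ , _ ∷ [] , s≤s () , _)
  acyclic (u , x ∷ y ∷ ys , _ , Vs , uniq@(_ ∷ uniq′) , es) with closed-walk ys Vs uniq es
  ... | walk@(Vu ∷ Vs′ , u~x ∷ es′ , _ , nb′) with orient Vu (All.head Vs′) u~x
  ...   | inj₂ x↑u = <-irrefl refl (All-last (x ∷ y ∷ ys) (descends (y ∷ ys ++ [ u ]) walk x↑u))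
  ...   | inj₁ u↑x with rises-or-falls-into ys (Vs′ , es′ , nb′)
  ...     | inj₁ (x↑y ∷ rising) = <-asym (↑-rank u↑x)
              (All-last (y ∷ ys) (Linked⇒All <-trans (↑-rank x↑y) (Linked.map ↑-rank rising)))
  ...     | inj₂ (z , z∈ , u↑z) = Unique.Unique[x∷xs]⇒x∉xs uniq′ (subst (_∈ y ∷ ys) (↑-functional u↑z u↑x) z∈)

cyc : ℕ → ℕ → ℕ → Cyc
cyc a b c = (a , b) , (b , c) , (a , c)

_IsRotationOf_ : Cyc → Cyc → Set
t IsRotationOf (p , q , r) = t ≡ (p , q , r) ⊎ t ≡ (q , r , p) ⊎ t ≡ (r , p , q)

pattern rot₀ = inj₁ refl
pattern rot₁ = inj₂ (inj₁ refl)
pattern rot₂ = inj₂ (inj₂ refl)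

pattern from-ab = inj₁ (refl , refl)
pattern from-bc = inj₂ (inj₁ (refl , refl))
pattern from-ac = inj₂ (inj₂ (refl , refl))

-- Only the three rotations of a single triangle survive; every other choice of
-- the three triangles forces a cycle in _<_.
follows-cycle : ∀ {x y z a b c a′ b′ c′ a″ b″ c″} →
                a < b → b < c → a′ < b′ → b′ < c′ → a″ < b″ → b″ < c″ →
                Follows a b c x y → Follows a′ b′ c′ y z → Follows a″ b″ c″ z x →
                (x , y , z) IsRotationOf cyc a b c
follows-cycle p₁ p₂ q₁ q₂ r₁ r₂ from-ab from-ab from-ab = ⊥-elim (<-irrefl refl (<-trans r₂ (<-trans q₁ r₁)))
follows-cycle p₁ p₂ q₁ q₂ r₁ r₂ from-ab from-ab from-bc = ⊥-elim (<-irrefl refl (<-trans r₂ q₁))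
follows-cycle p₁ p₂ q₁ q₂ r₁ r₂ from-ab from-ab from-ac = ⊥-elim (<-irrefl refl (<-trans q₁ r₁))
follows-cycle p₁ p₂ q₁ q₂ r₁ r₂ from-ab from-bc from-ab = ⊥-elim (<-irrefl refl (<-trans r₂ q₂))
follows-cycle p₁ p₂ q₁ q₂ r₁ r₂ from-ab from-bc from-bc = ⊥-elim (<-irrefl refl q₂)
follows-cycle p₁ p₂ q₁ q₂ r₁ r₂ from-ab from-bc from-ac = rot₀
follows-cycle p₁ p₂ q₁ q₂ r₁ r₂ from-ab from-ac from-ab = ⊥-elim (<-irrefl refl (<-trans r₂ r₁))
follows-cycle p₁ p₂ q₁ q₂ r₁ r₂ from-ab from-ac from-bc = ⊥-elim (<-irrefl refl r₂)
follows-cycle p₁ p₂ q₁ q₂ r₁ r₂ from-ab from-ac from-ac = ⊥-elim (<-irrefl refl r₁)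
follows-cycle p₁ p₂ q₁ q₂ r₁ r₂ from-bc from-ab from-ab = ⊥-elim (<-irrefl refl (<-trans r₂ r₁))
follows-cycle p₁ p₂ q₁ q₂ r₁ r₂ from-bc from-ab from-bc = ⊥-elim (<-irrefl refl r₂)
follows-cycle p₁ p₂ q₁ q₂ r₁ r₂ from-bc from-ab from-ac = ⊥-elim (<-irrefl refl r₁)
follows-cycle p₁ p₂ q₁ q₂ r₁ r₂ from-bc from-bc from-ab = ⊥-elim (<-irrefl refl r₂)
follows-cycle p₁ p₂ q₁ q₂ r₁ r₂ from-bc from-bc from-bc = ⊥-elim (<-irrefl refl (<-trans q₁ (<-trans p₁ r₁)))
follows-cycle p₁ p₂ q₁ q₂ r₁ r₂ from-bc from-bc from-ac = ⊥-elim (<-irrefl refl r₂)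
follows-cycle p₁ p₂ q₁ q₂ r₁ r₂ from-bc from-ac from-ab = rot₁
follows-cycle p₁ p₂ q₁ q₂ r₁ r₂ from-bc from-ac from-bc = ⊥-elim (<-irrefl refl (<-trans p₁ r₁))
follows-cycle p₁ p₂ q₁ q₂ r₁ r₂ from-bc from-ac from-ac = ⊥-elim (<-irrefl refl (<-trans r₂ q₂))
follows-cycle p₁ p₂ q₁ q₂ r₁ r₂ from-ac from-ab from-ab = ⊥-elim (<-irrefl refl (<-trans q₁ r₁))
follows-cycle p₁ p₂ q₁ q₂ r₁ r₂ from-ac from-ab from-bc = rot₂
follows-cycle p₁ p₂ q₁ q₂ r₁ r₂ from-ac from-ab from-ac = ⊥-elim (<-irrefl refl q₁)
follows-cycle p₁ p₂ q₁ q₂ r₁ r₂ from-ac from-bc from-ab = ⊥-elim (<-irrefl refl q₂)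
follows-cycle p₁ p₂ q₁ q₂ r₁ r₂ from-ac from-bc from-bc = ⊥-elim (<-irrefl refl (<-trans q₁ r₁))
follows-cycle p₁ p₂ q₁ q₂ r₁ r₂ from-ac from-bc from-ac = ⊥-elim (<-irrefl refl (<-trans r₂ p₂))
follows-cycle p₁ p₂ q₁ q₂ r₁ r₂ from-ac from-ac from-ab = ⊥-elim (<-irrefl refl r₁)
follows-cycle p₁ p₂ q₁ q₂ r₁ r₂ from-ac from-ac from-bc = ⊥-elim (<-irrefl refl r₁)
follows-cycle p₁ p₂ q₁ q₂ r₁ r₂ from-ac from-ac from-ac = ⊥-elim (<-irrefl refl (<-trans r₂ (<-trans q₂ p₂)))

Covers : Seg → Seg → Set
Covers (p , q) (a , c) = p ≤ a × c ≤ q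

IsInnerSide : Seg → ℕ → ℕ → ℕ → Set
IsInnerSide s a b c = s ≡ (a , b) ⊎ s ≡ (b , c)

span : Cyc → ℕ
span (_ , _ , (a , c)) = c ∸ a

module Triangulated (m : ℕ) (T : List Seg) (tri : IsTriangulation m T) where
  open IsTriangulation tri

  record Internal (a b c : ℕ) : Set where
    constructor internal
    field
      a<b : a < b
      b<c : b < c
      ab∈T : (a , b) ∈ T
      bc∈T : (b , c) ∈ T
      ac∈T : (a , c) ∈ T
  open Internal using (ac∈T)

  data InternalCyc : Cyc → Set where
    cycOf : ∀ {a b c} → Internal a b c → InternalCyc (cyc a b c)

  arc-bound : ∀ {a c} → (a , c) ∈ T → c < m
  arc-bound i = proj₂ (proj₁ (arcs i))

  arc-long : ∀ {a c} → (a , c) ∈ T → suc a < c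
  arc-long i with arcs i
  ... | (a<c , _) , (c≢1+a , _) = ≤∧≢⇒< a<c (c≢1+a ∘ sym)

  triangle : ∀ {a b c} → Internal a b c → IsTriangle m T a b c
  triangle (internal a<b b<c ab∈ bc∈ ac∈) = (a<b , b<c , arc-bound bc∈) , (inj₂ ab∈ , inj₂ bc∈ , inj₂ ac∈)

  internal⇒GVertex : ∀ {a b c} → Internal a b c → GVertex m T (cyc a b c)
  internal⇒GVertex I@(internal a<b b<c ab∈ bc∈ ac∈) =
    ( (ab∈ , bc∈ , _ , _ , _ , triangle I , from-ab)
    , (bc∈ , ac∈ , _ , _ , _ , triangle I , from-bc)
    , (ac∈ , ab∈ , _ , _ , _ , triangle I , from-ac))
    , inj₁ a<b , inj₂ (refl , b<c)

  cycle3-internal : ∀ {x y z} → Cycle3 m T x y z →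
                    ∃[ a ] ∃[ b ] ∃[ c ] Internal a b c × (x , y , z) IsRotationOf cyc a b c
  cycle3-internal ( (x∈ , y∈ , _ , _ , _ , ((p₁ , p₂ , _) , _) , f₁)
                  , (_ , z∈ , _ , _ , _ , ((q₁ , q₂ , _) , _) , f₂)
                  , (_ , _ , _ , _ , _ , ((r₁ , r₂ , _) , _) , f₃))
    with follows-cycle p₁ p₂ q₁ q₂ r₁ r₂ f₁ f₂ f₃
  ... | rot₀ = _ , _ , _ , internal p₁ p₂ x∈ y∈ z∈ , rot₀
  ... | rot₁ = _ , _ , _ , internal p₁ p₂ z∈ x∈ y∈ , rot₁
  ... | rot₂ = _ , _ , _ , internal p₁ p₂ y∈ z∈ x∈ , rot₂

  GVertex⇒internal : ∀ {t} → GVertex m T t → InternalCyc t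
  GVertex⇒internal (cy , x<y , _) with cycle3-internal cy
  ... | _ , _ , _ , I , rot₀ = cycOf I
  GVertex⇒internal (cy , inj₁ b<a , _)       | _ , _ , _ , I , rot₁ = ⊥-elim (<-asym (Internal.a<b I) b<a)
  GVertex⇒internal (cy , inj₂ (_ , c<c) , _) | _ , _ , _ , I , rot₁ = ⊥-elim (<-irrefl refl c<c)
  GVertex⇒internal (cy , inj₁ a<a , _)       | _ , _ , _ , I , rot₂ = ⊥-elim (<-irrefl refl a<a)
  GVertex⇒internal (cy , inj₂ (_ , c<b) , _) | _ , _ , _ , I , rot₂ = ⊥-elim (<-asym (Internal.b<c I) c<b)

  outer-unique : ∀ {a b b′ c} → Internal a b c → Internal a b′ c → b ≡ b′
  outer-unique {b = b} {b′} (internal a<b b<c ab∈ bc∈ _) (internal a<b′ b′<c ab′∈ b′c∈ _) with <-cmp b b′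
  ... | tri< b<b′ _ _ = ⊥-elim (noncrossing ab′∈ bc∈ (inj₁ (a<b , b<b′ , b′<c)))
  ... | tri≈ _ b≡b′ _ = b≡b′
  ... | tri> _ _ b′<b = ⊥-elim (noncrossing ab∈ b′c∈ (inj₁ (a<b′ , b′<b , b<c)))

  inner-unique : ∀ {s a b c a′ b′ c′} → Internal a b c → Internal a′ b′ c′ →
                 IsInnerSide s a b c → IsInnerSide s a′ b′ c′ → cyc a b c ≡ cyc a′ b′ c′
  inner-unique {c = c} {c′ = c′} (internal a<b b<c _ bc∈ ac∈) (internal _ b<c′ _ bc′∈ ac′∈) (inj₁ refl) (inj₁ refl)
    with <-cmp c c′
  ... | tri< c<c′ _ _ = ⊥-elim (noncrossing ac∈ bc′∈ (inj₁ (a<b , b<c , c<c′)))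
  ... | tri≈ _ refl _ = refl
  ... | tri> _ _ c′<c = ⊥-elim (noncrossing ac′∈ bc∈ (inj₁ (a<b , b<c′ , c′<c)))
  inner-unique {a = a} {a′ = a′} (internal a<b b<c ab∈ _ ac∈) (internal a′<b _ ab′∈ _ ac′∈) (inj₂ refl) (inj₂ refl)
    with <-cmp a a′
  ... | tri< a<a′ _ _ = ⊥-elim (noncrossing ab∈ ac′∈ (inj₁ (a<a′ , a′<b , b<c)))
  ... | tri≈ _ refl _ = refl
  ... | tri> _ _ a′<a = ⊥-elim (noncrossing ab′∈ ac∈ (inj₁ (a′<a , a<b , b<c)))
  inner-unique (internal a<b b<c _ _ ac∈) (internal a′<b′ _ _ _ ac′∈) (inj₁ refl) (inj₂ refl) =
    ⊥-elim (noncrossing ac′∈ ac∈ (inj₁ (a′<b′ , a<b , b<c)))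
  inner-unique (internal a<b b<c _ _ ac∈) (internal _ b′<c′ _ _ ac′∈) (inj₂ refl) (inj₁ refl) =
    ⊥-elim (noncrossing ac∈ ac′∈ (inj₁ (a<b , b<c , b′<c′)))

  inner∈T : ∀ {s a b c} → Internal a b c → IsInnerSide s a b c → s ∈ T
  inner∈T I (inj₁ refl) = Internal.ab∈T I
  inner∈T I (inj₂ refl) = Internal.bc∈T I

  inner-span : ∀ {p q a b c} → Internal a b c → IsInnerSide (p , q) a b c → q ∸ p < c ∸ a
  inner-span (internal a<b b<c _ _ _) (inj₁ refl) = ∸-monoˡ-< b<c (<⇒≤ a<b)
  inner-span (internal a<b b<c _ _ _) (inj₂ refl) = ∸-monoʳ-< a<b (<⇒≤ b<c)

  data _↑_ : Cyc → Cyc → Set where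
    parent : ∀ {a b c a′ b′ c′} → Internal a b c → Internal a′ b′ c′ → IsInnerSide (a , c) a′ b′ c′ →
             cyc a b c ↑ cyc a′ b′ c′

  ↑-functional : ∀ {t u v} → t ↑ u → t ↑ v → u ≡ v
  ↑-functional (parent _ J s) (parent _ J′ s′) = inner-unique J J′ s s′

  ↑-span : ∀ {t u} → t ↑ u → span t < span u
  ↑-span (parent _ J s) = inner-span J s

  ↑⇒GEdge : ∀ {t u} → t ↑ u → GEdge u t
  ↑⇒GEdge t↑u@(parent _ _ s) = (λ { refl → <-irrefl refl (↑-span t↑u) }) , _ , inCyc s , inj₂ (inj₂ refl)
    where
    inCyc : ∀ {v a b c} → IsInnerSide v a b c → InCyc v (cyc a b c)
    inCyc (inj₁ e) = inj₁ e
    inCyc (inj₂ e) = inj₂ (inj₁ e)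

  GEdge-sym : ∀ {t u} → GEdge t u → GEdge u t
  GEdge-sym (t≢u , v , v∈t , v∈u) = t≢u ∘ sym , v , v∈u , v∈t

  orient : ∀ {t u} → GVertex m T t → GVertex m T u → GEdge t u → t ↑ u ⊎ u ↑ t
  orient Gt Gu (t≢u , v , v∈t , v∈u) with GVertex⇒internal Gt | GVertex⇒internal Gu
  ... | cycOf I | cycOf J with assocˡ v∈t | assocˡ v∈u
  ...   | inj₁ inner | inj₁ inner′ = ⊥-elim (t≢u (inner-unique I J inner inner′))
  ...   | inj₁ inner | inj₂ refl   = inj₂ (parent J I inner)
  ...   | inj₂ refl  | inj₁ inner′ = inj₁ (parent I J inner′)
  ...   | inj₂ refl  | inj₂ refl   = ⊥-elim (t≢u (cong (λ b → cyc _ b _) (outer-unique I J)))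

  open Forest (GVertex m T) GEdge _↑_ span orient ↑-functional ↑-span using (acyclic) public

  edge? : ∀ e → Dec (EdgeOf m T e)
  edge? (a , b) =
    (((a <? b) ×-dec (b <? m)) ×-dec ((b ≟ suc a) ⊎-dec ((a ≟ 0) ×-dec (suc b ≟ m)))) ⊎-dec ((a , b) ∈? T)

  edge-noncrossing : ∀ {e s} → EdgeOf m T e → s ∈ T → ¬ Cross e s
  edge-noncrossing (inj₂ e∈) s∈ = noncrossing e∈ s∈
  edge-noncrossing (inj₁ (_ , inj₁ refl)) _ (inj₁ (i<r , r<1+i , _)) = <⇒≱ i<r (≤-pred r<1+i)
  edge-noncrossing (inj₁ (_ , inj₁ refl)) _ (inj₂ (_ , i<s , s<1+i)) = <⇒≱ i<s (≤-pred s<1+i)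
  edge-noncrossing (inj₁ (_ , inj₂ (refl , refl))) s∈ (inj₁ (_ , _ , j<s)) = <⇒≱ (arc-bound s∈) j<s
  edge-noncrossing (inj₁ (_ , inj₂ (refl , _))) _ (inj₂ (() , _))

  furthest-edge : ∀ {p q} j → p < j → j < q → q < m → (∀ {i} → j < i → i < q → ¬ EdgeOf m T (p , i)) →
                  ∃[ b ] p < b × b < q × EdgeOf m T (p , b) × (∀ {i} → b < i → i < q → ¬ EdgeOf m T (p , i))
  furthest-edge {p} j p<j j<q q<m beyond with edge? (p , j)
  ... | yes e = j , p<j , j<q , e , beyond
  furthest-edge {q = q} (suc j) p<1+j 1+j<q q<m beyond | no ¬e with m≤n⇒m<n∨m≡n (≤-pred p<1+j)
  ... | inj₂ refl = ⊥-elim (¬e (inj₁ ((p<1+j , <-trans 1+j<q q<m) , inj₁ refl)))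
  ... | inj₁ p<j = furthest-edge j p<j (<-trans (n<1+n j) 1+j<q) q<m beyond′
    where
    beyond′ : ∀ {i} → j < i → i < q → ¬ EdgeOf m T (_ , i)
    beyond′ j<i i<q with m≤n⇒m<n∨m≡n j<i
    ... | inj₁ 1+j<i = beyond 1+j<i i<q
    ... | inj₂ refl = ¬e

  -- The triangle of T on the inner side of (p , q) has as apex the furthest b
  -- with (p , b) an edge, for then no arc of T can cross (b , q).
  apex : ∀ {p q} → EdgeOf m T (p , q) → q < m → suc p < q →
         ∃[ b ] p < b × b < q × EdgeOf m T (p , b) × EdgeOf m T (b , q)
  apex {p} {suc q} Epq q<m (s≤s p<q)
    with furthest-edge q p<q ≤-refl q<m (λ q<i i<1+q → ⊥-elim (<⇒≱ q<i (≤-pred i<1+q)))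
  ... | b , p<b , b<q , Epb , furthest with edge? (b , suc q)
  ...   | yes Ebq = b , p<b , b<q , Epb , Ebq
  ...   | no ¬Ebq with maximal (b , suc q) ((b<q , q<m) , ¬side₁ , ¬side₂) (¬Ebq ∘ inj₂)
    where
    ¬side₁ : suc q ≢ suc b
    ¬side₁ eq = ¬Ebq (inj₁ ((b<q , q<m) , inj₁ eq))
    ¬side₂ : b ≡ 0 → suc (suc q) ≢ m
    ¬side₂ b≡0 eq = ¬Ebq (inj₁ ((b<q , q<m) , inj₂ (b≡0 , eq)))
  ...     | s , s∈ , cross = ⊥-elim (blocked s∈ cross)
    where
    blocked : ∀ {r s} → (r , s) ∈ T → ¬ Cross (b , suc q) (r , s)
    blocked rs∈ (inj₁ (b<r , r<q , q<s)) = edge-noncrossing Epq rs∈ (inj₁ (<-trans p<b b<r , r<q , q<s))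
    blocked {r} rs∈ (inj₂ (r<b , b<s , s<q)) with <-cmp r p
    ... | tri< r<p _ _ = edge-noncrossing Epq rs∈ (inj₂ (r<p , <-trans p<b b<s , s<q))
    ... | tri≈ _ refl _ = furthest b<s s<q (inj₂ rs∈)
    ... | tri> _ _ p<r = edge-noncrossing Epb rs∈ (inj₁ (p<r , r<b , b<s))

  nested-arc-splits : ∀ {p b q a c} → EdgeOf m T (p , b) → EdgeOf m T (b , q) → Covers (p , q) (a , c) →
                      (a , c) ∈ T → (p , q) ≢ (a , c) → c ≤ b ⊎ b ≤ a
  nested-arc-splits {b = b} {a = a} {c = c} Epb Ebq (p≤a , c≤q) ac∈ pq≢ac with c ≤? b | b ≤? a
  ... | yes c≤b | _ = inj₁ c≤b
  ... | no _ | yes b≤a = inj₂ b≤a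
  ... | no c≰b | no b≰a with m≤n⇒m<n∨m≡n p≤a | m≤n⇒m<n∨m≡n c≤q
  ...   | inj₁ p<a | _ = ⊥-elim (edge-noncrossing Epb ac∈ (inj₁ (p<a , ≰⇒> b≰a , ≰⇒> c≰b)))
  ...   | inj₂ refl | inj₁ c<q = ⊥-elim (edge-noncrossing Ebq ac∈ (inj₂ (≰⇒> b≰a , ≰⇒> c≰b , c<q)))
  ...   | inj₂ refl | inj₂ refl = ⊥-elim (pq≢ac refl)

  -- Of the sides of the polygon only the outer side (0 , m - 1) covers an arc.
  covering-edge∈T : ∀ {p q a c} → EdgeOf m T (p , q) → Covers (p , q) (a , c) → (a , c) ∈ T →
                    ¬ (p ≡ 0 × suc q ≡ m) → (p , q) ∈ T
  covering-edge∈T (inj₂ pq∈) _ _ _ = pq∈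
  covering-edge∈T (inj₁ (_ , inj₁ refl)) (p≤a , c≤q) ac∈ _ = ⊥-elim (<⇒≱ (arc-long ac∈) (≤-trans c≤q (s≤s p≤a)))
  covering-edge∈T (inj₁ (_ , inj₂ outer)) _ _ ¬outer = ⊥-elim (¬outer outer)

  module _ (hyp : AllIn3Cycles m T) where

    -- An arrow between two sides of a triangle lies on a 3-cycle, which can
    -- only be the triangle's own; so its third side is an arc as well.
    arrow⇒internal : ∀ {a b c x y} → IsTriangle m T a b c → Follows a b c x y → x ∈ T → y ∈ T → Internal a b c
    arrow⇒internal Δ@((a<b , b<c , _) , _) f x∈ y∈ with proj₂ hyp _ _ (x∈ , y∈ , _ , _ , _ , Δ , f)
    ... | _ , cy with cycle3-internal cy | f
    ... | _ , _ , _ , J , rot₀ | from-ab = J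
    ... | _ , _ , _ , J , rot₁ | from-ab = ⊥-elim (<-irrefl refl b<c)
    ... | _ , _ , _ , J , rot₂ | from-ab = ⊥-elim (<-irrefl refl a<b)
    ... | _ , _ , _ , J , rot₀ | from-bc = ⊥-elim (<-irrefl refl (<-trans a<b b<c))
    ... | _ , _ , _ , J , rot₁ | from-bc = J
    ... | _ , _ , _ , J , rot₂ | from-bc = ⊥-elim (<-irrefl refl a<b)
    ... | _ , _ , _ , J , rot₀ | from-ac = ⊥-elim (<-irrefl refl (Internal.a<b J))
    ... | _ , _ , _ , J , rot₁ | from-ac = ⊥-elim (<-irrefl refl b<c)
    ... | _ , _ , _ , J , rot₂ | from-ac = J

    covering-triangle : ∀ {p q a c} → (p , q) ∈ T → Covers (p , q) (a , c) → (a , c) ∈ T → (p , q) ≢ (a , c) →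
                        ∃[ b ] Internal p b q × ∃[ s ] IsInnerSide s p b q × Covers s (a , c)
    covering-triangle {p} {q} {a} {c} pq∈ (p≤a , c≤q) ac∈ pq≢ac
      with apex (inj₂ pq∈) (arc-bound pq∈) (arc-long pq∈)
    ... | b , p<b , b<q , Epb , Ebq = b , below (nested-arc-splits Epb Ebq (p≤a , c≤q) ac∈ pq≢ac)
      where
      Δ : IsTriangle m T p b q
      Δ = (p<b , b<q , arc-bound pq∈) , (Epb , Ebq , inj₂ pq∈)
      below : c ≤ b ⊎ b ≤ a → Internal p b q × ∃[ s ] IsInnerSide s p b q × Covers s (a , c)
      below (inj₁ c≤b) = arrow⇒internal Δ from-ac pq∈ pb∈ , _ , inj₁ refl , (p≤a , c≤b)
        where
        pb∈ : (p , b) ∈ T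
        pb∈ = covering-edge∈T Epb (p≤a , c≤b) ac∈ (λ (_ , 1+b≡m) → <⇒≢ (≤-<-trans b<q (arc-bound pq∈)) 1+b≡m)
      below (inj₂ b≤a) = arrow⇒internal Δ from-bc bq∈ pq∈ , _ , inj₂ refl , (b≤a , c≤q)
        where
        bq∈ : (b , q) ∈ T
        bq∈ = covering-edge∈T Ebq (b≤a , c≤q) ac∈ (λ (b≡0 , _) → <⇒≢ (≤-<-trans z≤n p<b) (sym b≡0))

    descend : ∀ {p q a b c} → Acc _<_ (q ∸ p) → (p , q) ∈ T → Covers (p , q) (a , c) → Internal a b c →
              ∃[ b′ ] Internal p b′ q × Walk (GVertex m T) GEdge (cyc p b′ q) (cyc a b c)
    descend {p} {q} {a} {b} {c} (acc smaller) pq∈ cov I with ≡-dec _≟_ _≟_ (p , q) (a , c)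
    ... | yes refl = b , I , here
    ... | no pq≢ac with covering-triangle pq∈ cov (ac∈T I) pq≢ac
    ...   | b′ , J , _ , side , cov′ with descend (smaller (inner-span J side)) (inner∈T J side) cov′ I
    ...     | _ , K , walk = b′ , J , step (↑⇒GEdge (parent K J side)) (internal⇒GVertex K) walk

    module _ {n : ℕ} (1+n≡m : suc n ≡ m) where

      below-outer-side : ∀ {a c} → (a , c) ∈ T → Covers (0 , n) (a , c) × (0 , n) ≢ (a , c)
      below-outer-side ac∈ = (z≤n , ≤-pred (subst (_ <_) (sym 1+n≡m) (arc-bound ac∈))) ,
                             λ { refl → proj₂ (proj₂ (arcs ac∈)) refl 1+n≡m }

      outer-edge : 0 < n → EdgeOf m T (0 , n)
      outer-edge 0<n = inj₁ ((0<n , ≤-reflexive 1+n≡m) , inj₂ (refl , 1+n≡m))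

      module RootTriangle {b : ℕ} (0<b : 0 < b) (b<n : b < n) (E₀ : EdgeOf m T (0 , b)) (E₁ : EdgeOf m T (b , n)) where

        below-half : ∀ {a c} → (a , c) ∈ T →
                     (Covers (0 , b) (a , c) × (0 , b) ∈ T) ⊎ (Covers (b , n) (a , c) × (b , n) ∈ T)
        below-half ac∈ with below-outer-side ac∈
        ... | (_ , c≤n) , outer≢ac with nested-arc-splits E₀ E₁ (z≤n , c≤n) ac∈ outer≢ac
        ...   | inj₁ c≤b = inj₁ ((z≤n , c≤b) , covering-edge∈T E₀ (z≤n , c≤b) ac∈ λ (_ , 1+b≡m) →
                                 <⇒≢ b<n (suc-injective (trans 1+b≡m (sym 1+n≡m))))
        ...   | inj₂ b≤a = inj₂ ((b≤a , c≤n) , covering-edge∈T E₁ (b≤a , c≤n) ac∈ λ (b≡0 , _) →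
                                 <⇒≢ 0<b (sym b≡0))

        -- Otherwise the root triangle would be internal and (0 , n) an arc.
        not-both-halves : (0 , b) ∈ T → (b , n) ∈ T → ⊥
        not-both-halves 0b∈ bn∈ = proj₂ (proj₂ (arcs (ac∈T root))) refl 1+n≡m
          where
          root : Internal 0 b n
          root = arrow⇒internal ((0<b , b<n , ≤-reflexive 1+n≡m) , (E₀ , E₁ , outer-edge (<-trans 0<b b<n)))
                                from-ab 0b∈ bn∈

        top : ∀ {a₀ c₀} → (a₀ , c₀) ∈ T → ∃[ t ] t ∈ T × (∀ {a c} → (a , c) ∈ T → Covers t (a , c))
        top i₀ with below-half i₀
        ... | inj₁ (_ , 0b∈) = _ , 0b∈ , [ proj₁ , ⊥-elim ∘ not-both-halves 0b∈ ∘ proj₂ ]′ ∘ below-half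
        ... | inj₂ (_ , bn∈) = _ , bn∈ , [ ⊥-elim ∘ flip not-both-halves bn∈ ∘ proj₂ , proj₁ ]′ ∘ below-half

      top-arc : ∀ {a₀ c₀} → (a₀ , c₀) ∈ T → ∃[ t ] t ∈ T × (∀ {a c} → (a , c) ∈ T → Covers t (a , c))
      top-arc i₀ with apex (outer-edge (<-trans z<s 1<n)) (≤-reflexive 1+n≡m) 1<n
        where
        1<n : 1 < n
        1<n = ≤-trans (s≤s (s≤s z≤n)) (≤-trans (arc-long i₀) (proj₂ (proj₁ (below-outer-side i₀))))
      ... | b , 0<b , b<n , E₀ , E₁ = RootTriangle.top 0<b b<n E₀ E₁ i₀

    connected : ∀ t u → GVertex m T t → GVertex m T u → Walk (GVertex m T) GEdge t u
    connected _ _ Gt Gu with GVertex⇒internal Gt | GVertex⇒internal Gu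
    ... | cycOf I | cycOf J with top-arc (suc-pred m {{>-nonZero (≤-<-trans z≤n (arc-bound (ac∈T I)))}}) (ac∈T I)
    ...   | _ , top∈ , covers with descend (<-wellFounded _) top∈ (covers (ac∈T I)) I
                                 | descend (<-wellFounded _) top∈ (covers (ac∈T J)) J
    ...     | _ , K , top→I | _ , K′ , top→J with outer-unique K K′
    ...       | refl = walk-++ (walk-reverse GEdge-sym (internal⇒GVertex K) top→I) top→J

    nonempty : ∀ {x} → x ∈ T → Σ Cyc (GVertex m T)
    nonempty x∈ with proj₁ hyp _ x∈
    ... | _ , _ , cy with cycle3-internal cy
    ...   | _ , _ , _ , I , _ = _ , internal⇒GVertex I

lemma5p4 : (m : ℕ) (T : List Seg) → IsTriangulation m T → T ≢ [] →
           AllIn3Cycles m T → IsTree (GVertex m T) GEdge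
lemma5p4 m [] _ T≢[] _ = ⊥-elim (T≢[] refl)
lemma5p4 m T@(_ ∷ _) tri _ hyp = record
  { nonempty  = nonempty hyp (here refl)
  ; connected = connected hyp
  ; acyclic   = acyclic
  }
  where open Triangulated m T tri
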